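{- For any two integers $t_1\geq 2$ and $t_2=t_1+1$, there exist a connected graph $G$ and a function $g:V(G_1)\to V(G_2)$ (where $G_1,G_2$ are disjoint copies of $G$) such that $fix(G)=t_1$ and $fix(F_G)=t_2$.
   Context: All graphs are finite and simple. A set $S\subseteq V(H)$ is a fixing set of a graph $H$ if the only automorphism of $H$ fixing every vertex of $S$ is the identity; $fix(H)$ is the minimum cardinality of a fixing set of $H$. Functigraph: for disjoint copies $G_1,G_2$ of $G$, $A=V(G_1)$, $B=V(G_2)$ and a function $g:A\to B$, $F_G$ is the graph with vertex set $A\cup B$ and edge set $E(G_1)\cup E(G_2)\cup\{uv:u\in A,\ v=g(u)\}$. -}

module Defs where

open import Data.Nat using (ℕ; _+_; _≤_)
open import Data.Bool using (Bool; true; false)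
open import Data.Fin using (Fin; splitAt; _≟_)
open import Data.Fin.Subset using (Subset; _∈_; ∣_∣)
open import Data.Fin.Permutation using (Permutation′; _⟨$⟩ʳ_)
open import Data.Sum using (inj₁; inj₂)
open import Data.Product using (Σ; _×_)
open import Relation.Binary.PropositionalEquality using (_≡_)
open import Relation.Nullary.Decidable using (⌊_⌋)

Adj : ℕ → Set
Adj n = Fin n → Fin n → Bool

IsSimple : ∀ {n} → Adj n → Set
IsSimple {n} adj = (∀ (u v : Fin n) → adj u v ≡ adj v u) × (∀ (u : Fin n) → adj u u ≡ false)

data Reachable {n} (adj : Adj n) : Fin n → Fin n → Set where
  here : ∀ {u} → Reachable adj u u
  step : ∀ {u w v} → adj u w ≡ true → Reachable adj w v → Reachable adj u v

IsConnected : ∀ {n} → Adj n → Set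
IsConnected {n} adj = ∀ (u v : Fin n) → Reachable adj u v

IsAutomorphism : ∀ {n} → Adj n → Permutation′ n → Set
IsAutomorphism {n} adj σ = ∀ (u v : Fin n) → adj (σ ⟨$⟩ʳ u) (σ ⟨$⟩ʳ v) ≡ adj u v

IsFixingSet : ∀ {n} → Adj n → Subset n → Set
IsFixingSet {n} adj S =
  ∀ (σ : Permutation′ n) → IsAutomorphism adj σ →
  (∀ (v : Fin n) → v ∈ S → σ ⟨$⟩ʳ v ≡ v) → ∀ (v : Fin n) → σ ⟨$⟩ʳ v ≡ v

FixNumber : ∀ {n} → Adj n → ℕ → Set
FixNumber {n} adj k =
  Σ (Subset n) (λ S → IsFixingSet adj S × ∣ S ∣ ≡ k)
  × (∀ (S : Subset n) → IsFixingSet adj S → k ≤ ∣ S ∣)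

-- Functigraph F_G on Fin (n + n): the first n vertices are the copy G₁ (set A),
-- the last n the copy G₂ (set B); u ∈ A is joined to g u ∈ B.
functigraph : ∀ {n} → Adj n → (Fin n → Fin n) → Adj (n + n)
functigraph {n} adj g x y with splitAt n x | splitAt n y
... | inj₁ a | inj₁ b = adj a b
... | inj₂ a | inj₂ b = adj a b
... | inj₁ a | inj₂ b = ⌊ g a ≟ b ⌋
... | inj₂ b | inj₁ a = ⌊ g a ≟ b ⌋

module Submission where

-- For m ≥ 2 let G_m consist of a clique x₀,…,x_{m−1}, a centre c
-- adjacent to every clique vertex, and a pendant vertex d attached to c; the
-- function g exchanges d and c and fixes every clique vertex.  With m = t₁ + 1:
--
-- Two distinct clique vertices of G_m are twins, so their
--    transposition is an automorphism and every fixing set meets every pair of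
--    clique vertices; such a set misses at most one of them, whence fix(G) ≥ m − 1.
--    In F_G the transposition of x_i, x_j, performed in both copies, is still an
--    automorphism (it commutes with g), and the two copies of d are twins.  Hence
--    the "shadow" of a fixing set of F_G (the vertices of G having a copy in it)
--    contains d and all clique vertices but one, so fix(F_G) ≥ m.
--  * Upper bounds.  The clique minus x₀ fixes G, and its copy in G₁ together
--    with the copy of d in G₁ fixes F_G: every remaining vertex but one is pinned
--    down by its adjacencies to vertices already known to be fixed, and the last
--    one is then fixed because an automorphism is a permutation.

open import Data.Bool using (Bool; true; false; not)
open import Data.Empty using (⊥-elim) renaming (⊥ to Empty)
open import Data.Fin using (Fin; zero; suc; splitAt; join; _↑ˡ_; _↑ʳ_; _≟_)
open import Data.Fin.Permutation using (Permutation′; _⟨$⟩ʳ_; _⟨$⟩ˡ_; inverseˡ; inverseʳ; permutation; transpose)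
open import Data.Fin.Properties using (splitAt-↑ˡ; splitAt-↑ʳ; splitAt⁻¹-↑ˡ; splitAt⁻¹-↑ʳ; ↑ˡ-injective; suc-injective; any?)
open import Data.Fin.Subset using (Subset; _∈_; ∣_∣; ⊤; ⊥; inside; outside; _∪_)
open import Data.Fin.Subset.Properties using (_∈?_; drop-there; ∈⊤; ∣p∣≤∣x∷p∣; ∣⊤∣≡n; ∣⊥∣≡0; p⊆p∪q; q⊆p∪q; p⊆q⇒∣p∣≤∣q∣)
open import Data.Nat using (ℕ; zero; suc; _+_; _≤_; z≤n; s≤s)
open import Data.Nat.Properties using (≤-trans; ≤-reflexive; ≤-pred; +-suc; +-monoʳ-≤; +-identityʳ)
open import Data.Product using (Σ; _×_; _,_; ∃-syntax)
open import Data.Sum using (_⊎_; inj₁; inj₂; [_,_]′)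
import Data.Sum as Sum
open import Data.Vec using ([]; _∷_; _++_; take; drop; lookup; here; there)
open import Data.Vec.Properties using (take++drop≡id; lookup-++ˡ; lookup-++ʳ; []=⇒lookup; lookup⇒[]=)
open import Function using (_∘_)
open import Relation.Binary.PropositionalEquality
open import Relation.Nullary using (yes; no)
open import Relation.Nullary.Decidable using (⌊_⌋; ¬?; _×-dec_; dec-true; dec-false; isYes≗does)

open import Defs

open ≡-Reasoning

private variable
  n : ℕ

-- Permutations and transpositions

perm-injective : (σ : Permutation′ n) {u v : Fin n} → σ ⟨$⟩ʳ u ≡ σ ⟨$⟩ʳ v → u ≡ v
perm-injective σ {u} {v} eq = begin
  u                  ≡⟨ inverseˡ σ ⟨
  σ ⟨$⟩ˡ (σ ⟨$⟩ʳ u)  ≡⟨ cong (σ ⟨$⟩ˡ_) eq ⟩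
  σ ⟨$⟩ˡ (σ ⟨$⟩ʳ v)  ≡⟨ inverseˡ σ ⟩
  v                  ∎

-- A permutation fixing all points but one fixes every point (the remaining
-- one has nowhere else to go); this settles the last vertex in the upper bounds.
fixes-all-but-one : (σ : Permutation′ n) (v : Fin n) → (∀ w → w ≢ v → σ ⟨$⟩ʳ w ≡ w) →
  ∀ w → σ ⟨$⟩ʳ w ≡ w
fixes-all-but-one σ v fixes-others w with w ≟ v
... | no w≢v = fixes-others w w≢v
... | yes refl with σ ⟨$⟩ʳ v ≟ v
...   | yes fixed = fixed
...   | no moved = perm-injective σ (fixes-others (σ ⟨$⟩ʳ v) moved)

⌊≟⌋-true : {a b : Fin n} → ⌊ a ≟ b ⌋ ≡ true → a ≡ b
⌊≟⌋-true {a = a} {b} eq with a ≟ b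
... | yes a≡b = a≡b
⌊≟⌋-true () | no _

⌊≟⌋-refl : (a : Fin n) → ⌊ a ≟ a ⌋ ≡ true
⌊≟⌋-refl a = trans (isYes≗does (a ≟ a)) (dec-true (a ≟ a) refl)

⌊≟⌋-sym : (a b : Fin n) → ⌊ a ≟ b ⌋ ≡ ⌊ b ≟ a ⌋
⌊≟⌋-sym a b with a ≟ b | b ≟ a
... | yes _ | yes _ = refl
... | no _ | no _ = refl
... | yes refl | no b≢a = ⊥-elim (b≢a refl)
... | no a≢b | yes refl = ⊥-elim (a≢b refl)

⌊≟⌋-distinct : {a b : Fin n} → a ≢ b → ⌊ a ≟ b ⌋ ≡ false
⌊≟⌋-distinct {a = a} {b} a≢b = trans (isYes≗does (a ≟ b)) (dec-false (a ≟ b) a≢b)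

⌊≟⌋-perm : (π : Permutation′ n) (a b : Fin n) → ⌊ π ⟨$⟩ʳ a ≟ π ⟨$⟩ʳ b ⌋ ≡ ⌊ a ≟ b ⌋
⌊≟⌋-perm π a b with π ⟨$⟩ʳ a ≟ π ⟨$⟩ʳ b | a ≟ b
... | yes _ | yes _ = refl
... | no _ | no _ = refl
... | yes eq | no a≢b = ⊥-elim (a≢b (perm-injective π eq))
... | no neq | yes refl = ⊥-elim (neq refl)

data Position {n} (u v : Fin n) : Fin n → Set where
  at-u : Position u v u
  at-v : v ≢ u → Position u v v
  elsewhere : ∀ {k} → k ≢ u → k ≢ v → Position u v k

position : (u v k : Fin n) → Position u v k
position u v k with k ≟ u
... | yes refl = at-u
... | no k≢u with k ≟ v
...   | yes refl = at-v k≢u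
...   | no k≢v = elsewhere k≢u k≢v

transpose-u : (u v : Fin n) → transpose u v ⟨$⟩ʳ u ≡ v
transpose-u u v rewrite dec-true (u ≟ u) refl = refl

transpose-v : (u v : Fin n) → transpose u v ⟨$⟩ʳ v ≡ u
transpose-v u v with v ≟ u
... | yes v≡u = v≡u
... | no _ rewrite dec-true (v ≟ v) refl = refl

transpose-other : (u v : Fin n) {k : Fin n} → k ≢ u → k ≢ v → transpose u v ⟨$⟩ʳ k ≡ k
transpose-other u v {k} k≢u k≢v rewrite dec-false (k ≟ u) k≢u | dec-false (k ≟ v) k≢v = refl

transpose-moves : (u v : Fin n) → u ≢ v → transpose u v ⟨$⟩ʳ u ≢ u
transpose-moves u v u≢v eq = u≢v (sym (trans (sym (transpose-u u v)) eq))

moved-by-transpose : (u v : Fin n) {w : Fin n} → transpose u v ⟨$⟩ʳ w ≢ w → w ≡ u ⊎ w ≡ v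
moved-by-transpose u v {w} moved with position u v w
... | at-u = inj₁ refl
... | at-v _ = inj₂ refl
... | elsewhere w≢u w≢v = ⊥-elim (moved (transpose-other u v w≢u w≢v))

transpose-commutes : (f : Fin n → Fin n) (u v : Fin n) → f u ≡ u → f v ≡ v →
  (∀ k → f k ≡ u → k ≡ u) → (∀ k → f k ≡ v → k ≡ v) →
  ∀ k → f (transpose u v ⟨$⟩ʳ k) ≡ transpose u v ⟨$⟩ʳ (f k)
transpose-commutes f u v fu fv only-u only-v k with position u v k
... | at-u = begin
  f (τ u)   ≡⟨ cong f (transpose-u u v) ⟩
  f v       ≡⟨ fv ⟩
  v         ≡⟨ transpose-u u v ⟨
  τ u       ≡⟨ cong τ fu ⟨
  τ (f u)   ∎
  where τ = transpose u v ⟨$⟩ʳ_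
... | at-v _ = begin
  f (τ v)   ≡⟨ cong f (transpose-v u v) ⟩
  f u       ≡⟨ fu ⟩
  u         ≡⟨ transpose-v u v ⟨
  τ v       ≡⟨ cong τ fv ⟨
  τ (f v)   ∎
  where τ = transpose u v ⟨$⟩ʳ_
... | elsewhere k≢u k≢v = begin
  f (τ k)   ≡⟨ cong f (transpose-other u v k≢u k≢v) ⟩
  f k       ≡⟨ transpose-other u v (k≢u ∘ only-u k) (k≢v ∘ only-v k) ⟨
  τ (f k)   ∎
  where τ = transpose u v ⟨$⟩ʳ_

-- Automorphisms, twins and fixing sets

adjacency-to-fixed : (adj : Adj n) (σ : Permutation′ n) → IsAutomorphism adj σ →
  ∀ {s} → σ ⟨$⟩ʳ s ≡ s → ∀ v → adj (σ ⟨$⟩ʳ v) s ≡ adj v s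
adjacency-to-fixed adj σ aut {s} fixed v = trans (cong (adj (σ ⟨$⟩ʳ v)) (sym fixed)) (aut v s)

distinct-from-fixed : (σ : Permutation′ n) {s v : Fin n} → σ ⟨$⟩ʳ s ≡ s → v ≢ s → σ ⟨$⟩ʳ v ≢ s
distinct-from-fixed σ fixed v≢s eq = v≢s (perm-injective σ (trans eq (sym fixed)))

fixingSet-meets-support : (adj : Adj n) (S : Subset n) → IsFixingSet adj S →
  (σ : Permutation′ n) → IsAutomorphism adj σ → ∀ {u} → σ ⟨$⟩ʳ u ≢ u →
  ∃[ w ] (w ∈ S × σ ⟨$⟩ʳ w ≢ w)
fixingSet-meets-support adj S fixing σ aut {u} u-moved
  with any? (λ w → (w ∈? S) ×-dec ¬? (σ ⟨$⟩ʳ w ≟ w))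
... | yes found = found
... | no none = ⊥-elim (u-moved (fixing σ aut fixes-S u))
  where
  fixes-S : ∀ w → w ∈ S → σ ⟨$⟩ʳ w ≡ w
  fixes-S w w∈S with σ ⟨$⟩ʳ w ≟ w
  ... | yes fixed = fixed
  ... | no moved = ⊥-elim (none (w , w∈S , moved))

Twins : Adj n → Fin n → Fin n → Set
Twins {n} adj u v = ∀ (w : Fin n) → w ≢ u → w ≢ v → adj u w ≡ adj v w

twins-transposition : (adj : Adj n) → IsSimple adj → ∀ {u v} → Twins adj u v →
  IsAutomorphism adj (transpose u v)
twins-transposition adj (sym-adj , loopless) {u} {v} twins x y with position u v x | position u v y
... | at-u | at-u rewrite transpose-u u v = trans (loopless v) (sym (loopless u))
... | at-u | at-v _ rewrite transpose-u u v | transpose-v u v = sym-adj v u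
... | at-u | elsewhere y≢u y≢v rewrite transpose-u u v | transpose-other u v y≢u y≢v =
  sym (twins y y≢u y≢v)
... | at-v _ | at-u rewrite transpose-u u v | transpose-v u v = sym-adj u v
... | at-v _ | at-v _ rewrite transpose-v u v = trans (loopless u) (sym (loopless v))
... | at-v _ | elsewhere y≢u y≢v rewrite transpose-v u v | transpose-other u v y≢u y≢v =
  twins y y≢u y≢v
... | elsewhere x≢u x≢v | at-u rewrite transpose-u u v | transpose-other u v x≢u x≢v =
  trans (sym-adj x v) (trans (sym (twins x x≢u x≢v)) (sym-adj u x))
... | elsewhere x≢u x≢v | at-v _ rewrite transpose-v u v | transpose-other u v x≢u x≢v =
  trans (sym-adj x u) (trans (twins x x≢u x≢v) (sym-adj v x))
... | elsewhere x≢u x≢v | elsewhere y≢u y≢v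
  rewrite transpose-other u v x≢u x≢v | transpose-other u v y≢u y≢v = refl

fixingSet-meets-twins : (adj : Adj n) → IsSimple adj → ∀ {u v} → u ≢ v → Twins adj u v →
  (S : Subset n) → IsFixingSet adj S → u ∈ S ⊎ v ∈ S
fixingSet-meets-twins adj simple {u} {v} u≢v twins S fixing
  with fixingSet-meets-support adj S fixing (transpose u v)
         (twins-transposition adj simple twins) (transpose-moves u v u≢v)
... | w , w∈S , w-moved with moved-by-transpose u v w-moved
...   | inj₁ refl = inj₁ w∈S
...   | inj₂ refl = inj₂ w∈S

-- Counting

MeetsAllPairs : Subset n → Set
MeetsAllPairs {n} p = ∀ (i j : Fin n) → i ≢ j → i ∈ p ⊎ j ∈ p

meetsAllPairs-size : (p : Subset n) → MeetsAllPairs p → n ≤ suc ∣ p ∣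
meetsAllPairs-size [] _ = z≤n
meetsAllPairs-size (inside ∷ p) meets = s≤s (meetsAllPairs-size p meets-tail)
  where
  meets-tail : MeetsAllPairs p
  meets-tail i j i≢j =
    Sum.map drop-there drop-there (meets (suc i) (suc j) (i≢j ∘ suc-injective))
meetsAllPairs-size {suc n} (outside ∷ p) meets =
  s≤s (subst (_≤ ∣ p ∣) (∣⊤∣≡n n) (p⊆q⇒∣p∣≤∣q∣ {p = ⊤} (λ {i} _ → all i)))
  where
  -- once the first point is missed, every other point must be present
  all : ∀ i → i ∈ p
  all i with meets zero (suc i) (λ ())
  ... | inj₁ ()
  ... | inj₂ (there i∈p) = i∈p

∣p∪q∣≤∣p∣+∣q∣ : (p q : Subset n) → ∣ p ∪ q ∣ ≤ ∣ p ∣ + ∣ q ∣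
∣p∪q∣≤∣p∣+∣q∣ [] [] = z≤n
∣p∪q∣≤∣p∣+∣q∣ (inside ∷ p) (b ∷ q) =
  s≤s (≤-trans (∣p∪q∣≤∣p∣+∣q∣ p q) (+-monoʳ-≤ ∣ p ∣ (∣p∣≤∣x∷p∣ b q)))
∣p∪q∣≤∣p∣+∣q∣ (outside ∷ p) (inside ∷ q) rewrite +-suc ∣ p ∣ ∣ q ∣ = s≤s (∣p∪q∣≤∣p∣+∣q∣ p q)
∣p∪q∣≤∣p∣+∣q∣ (outside ∷ p) (outside ∷ q) = ∣p∪q∣≤∣p∣+∣q∣ p q

∣p++q∣ : ∀ {k l} (p : Subset k) (q : Subset l) → ∣ p ++ q ∣ ≡ ∣ p ∣ + ∣ q ∣
∣p++q∣ [] q = refl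
∣p++q∣ (inside ∷ p) q = cong suc (∣p++q∣ p q)
∣p++q∣ (outside ∷ p) q = ∣p++q∣ p q

∈++ˡ : ∀ {k l} (p : Subset k) (q : Subset l) {i : Fin k} → i ∈ p → (i ↑ˡ l) ∈ (p ++ q)
∈++ˡ p q {i} i∈p = lookup⇒[]= _ (p ++ q) (trans (lookup-++ˡ p q i) ([]=⇒lookup i∈p))

-- Functigraphs

module Functigraph {m : ℕ} (adj : Adj m) (g : Fin m → Fin m) where

  F : Adj (m + m)
  F = functigraph adj g

  A B : Fin m → Fin (m + m)
  A a = a ↑ˡ m
  B b = m ↑ʳ b

  data Copy : Fin (m + m) → Set where
    copy₁ : ∀ a → Copy (A a)
    copy₂ : ∀ b → Copy (B b)

  copy : ∀ x → Copy x
  copy x with splitAt m x in eq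
  ... | inj₁ a = subst Copy (splitAt⁻¹-↑ˡ eq) (copy₁ a)
  ... | inj₂ b = subst Copy (splitAt⁻¹-↑ʳ eq) (copy₂ b)

  A≢B : ∀ a b → A a ≢ B b
  A≢B a b eq with trans (sym (splitAt-↑ˡ m a m)) (trans (cong (splitAt m) eq) (splitAt-↑ʳ m m b))
  ... | ()

  adjᴬᴬ : ∀ a b → F (A a) (A b) ≡ adj a b
  adjᴬᴬ a b rewrite splitAt-↑ˡ m a m | splitAt-↑ˡ m b m = refl

  adjᴮᴮ : ∀ a b → F (B a) (B b) ≡ adj a b
  adjᴮᴮ a b rewrite splitAt-↑ʳ m m a | splitAt-↑ʳ m m b = refl

  adjᴬᴮ : ∀ a b → F (A a) (B b) ≡ ⌊ g a ≟ b ⌋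
  adjᴬᴮ a b rewrite splitAt-↑ˡ m a m | splitAt-↑ʳ m m b = refl

  adjᴮᴬ : ∀ b a → F (B b) (A a) ≡ ⌊ g a ≟ b ⌋
  adjᴮᴬ b a rewrite splitAt-↑ˡ m a m | splitAt-↑ʳ m m b = refl

  F-simple : IsSimple adj → IsSimple F
  F-simple (sym-adj , loopless) = F-sym , F-loopless
    where
    F-sym : ∀ x y → F x y ≡ F y x
    F-sym x y with copy x | copy y
    ... | copy₁ a | copy₁ b = trans (adjᴬᴬ a b) (trans (sym-adj a b) (sym (adjᴬᴬ b a)))
    ... | copy₂ a | copy₂ b = trans (adjᴮᴮ a b) (trans (sym-adj a b) (sym (adjᴮᴮ b a)))
    ... | copy₁ a | copy₂ b = trans (adjᴬᴮ a b) (sym (adjᴮᴬ b a))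
    ... | copy₂ b | copy₁ a = trans (adjᴮᴬ b a) (sym (adjᴬᴮ a b))
    F-loopless : ∀ x → F x x ≡ false
    F-loopless x with copy x
    ... | copy₁ a = trans (adjᴬᴬ a a) (loopless a)
    ... | copy₂ a = trans (adjᴮᴮ a a) (loopless a)

  lift-map : (Fin m → Fin m) → Fin (m + m) → Fin (m + m)
  lift-map f x = join m m (Sum.map f f (splitAt m x))

  lift-map-A : ∀ f a → lift-map f (A a) ≡ A (f a)
  lift-map-A f a rewrite splitAt-↑ˡ m a m = refl

  lift-map-B : ∀ f b → lift-map f (B b) ≡ B (f b)
  lift-map-B f b rewrite splitAt-↑ʳ m m b = refl

  lift-map-inverse : (f h : Fin m → Fin m) → (∀ a → f (h a) ≡ a) → ∀ x → lift-map f (lift-map h x) ≡ x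
  lift-map-inverse f h f∘h x with copy x
  ... | copy₁ a rewrite lift-map-A h a | lift-map-A f (h a) | f∘h a = refl
  ... | copy₂ b rewrite lift-map-B h b | lift-map-B f (h b) | f∘h b = refl

  lift : Permutation′ m → Permutation′ (m + m)
  lift π = permutation (lift-map (π ⟨$⟩ʳ_)) (lift-map (π ⟨$⟩ˡ_))
    (lift-map-inverse (π ⟨$⟩ʳ_) (π ⟨$⟩ˡ_) (λ _ → inverseʳ π))
    (lift-map-inverse (π ⟨$⟩ˡ_) (π ⟨$⟩ʳ_) (λ _ → inverseˡ π))

  Commutes : Permutation′ m → Set
  Commutes π = ∀ a → g (π ⟨$⟩ʳ a) ≡ π ⟨$⟩ʳ g a

  lift-automorphism : (π : Permutation′ m) → IsAutomorphism adj π → Commutes π →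
    IsAutomorphism F (lift π)
  lift-automorphism π aut comm x y with copy x | copy y
  ... | copy₁ a | copy₁ b rewrite lift-map-A (π ⟨$⟩ʳ_) a | lift-map-A (π ⟨$⟩ʳ_) b
        | adjᴬᴬ (π ⟨$⟩ʳ a) (π ⟨$⟩ʳ b) | adjᴬᴬ a b = aut a b
  ... | copy₂ a | copy₂ b rewrite lift-map-B (π ⟨$⟩ʳ_) a | lift-map-B (π ⟨$⟩ʳ_) b
        | adjᴮᴮ (π ⟨$⟩ʳ a) (π ⟨$⟩ʳ b) | adjᴮᴮ a b = aut a b
  ... | copy₁ a | copy₂ b rewrite lift-map-A (π ⟨$⟩ʳ_) a | lift-map-B (π ⟨$⟩ʳ_) b
        | adjᴬᴮ (π ⟨$⟩ʳ a) (π ⟨$⟩ʳ b) | adjᴬᴮ a b | comm a = ⌊≟⌋-perm π (g a) b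
  ... | copy₂ b | copy₁ a rewrite lift-map-A (π ⟨$⟩ʳ_) a | lift-map-B (π ⟨$⟩ʳ_) b
        | adjᴮᴬ (π ⟨$⟩ʳ b) (π ⟨$⟩ʳ a) | adjᴮᴬ b a | comm a = ⌊≟⌋-perm π (g a) b

  -- The shadow of a vertex set S of F_G: the vertices of G with a copy in S.
  shadow : Subset (m + m) → Subset m
  shadow S = take m S ∪ drop m S

  ∈shadowᴬ : (S : Subset (m + m)) {a : Fin m} → A a ∈ S → a ∈ shadow S
  ∈shadowᴬ S {a} Aa∈S = p⊆p∪q (drop m S) (lookup⇒[]= a (take m S) (begin
    lookup (take m S) a                    ≡⟨ lookup-++ˡ (take m S) (drop m S) a ⟨
    lookup (take m S ++ drop m S) (A a)    ≡⟨ cong (λ T → lookup T (A a)) (take++drop≡id m S) ⟩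
    lookup S (A a)                         ≡⟨ []=⇒lookup Aa∈S ⟩
    inside                                 ∎))

  ∈shadowᴮ : (S : Subset (m + m)) {b : Fin m} → B b ∈ S → b ∈ shadow S
  ∈shadowᴮ S {b} Bb∈S = q⊆p∪q (take m S) (drop m S) (lookup⇒[]= b (drop m S) (begin
    lookup (drop m S) b                    ≡⟨ lookup-++ʳ (take m S) (drop m S) b ⟨
    lookup (take m S ++ drop m S) (B b)    ≡⟨ cong (λ T → lookup T (B b)) (take++drop≡id m S) ⟩
    lookup S (B b)                         ≡⟨ []=⇒lookup Bb∈S ⟩
    inside                                 ∎))

  ∣shadow∣≤∣S∣ : (S : Subset (m + m)) → ∣ shadow S ∣ ≤ ∣ S ∣
  ∣shadow∣≤∣S∣ S = ≤-trans (∣p∪q∣≤∣p∣+∣q∣ (take m S) (drop m S)) (≤-reflexive (begin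
    ∣ take m S ∣ + ∣ drop m S ∣    ≡⟨ ∣p++q∣ (take m S) (drop m S) ⟨
    ∣ take m S ++ drop m S ∣       ≡⟨ cong ∣_∣ (take++drop≡id m S) ⟩
    ∣ S ∣                          ∎))

  shadow-meets-support : (S : Subset (m + m)) → IsFixingSet F S →
    (π : Permutation′ m) → IsAutomorphism adj π → Commutes π → ∀ {u} → π ⟨$⟩ʳ u ≢ u →
    ∃[ a ] (a ∈ shadow S × π ⟨$⟩ʳ a ≢ a)
  shadow-meets-support S fixing π aut comm {u} u-moved
    with fixingSet-meets-support F S fixing (lift π) (lift-automorphism π aut comm) Au-moved
    where
    Au-moved : lift π ⟨$⟩ʳ A u ≢ A u
    Au-moved eq = u-moved (↑ˡ-injective m _ _ (trans (sym (lift-map-A (π ⟨$⟩ʳ_) u)) eq))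
  ... | w , w∈S , w-moved with copy w
  ...   | copy₁ a = a , ∈shadowᴬ S w∈S , λ eq → w-moved (trans (lift-map-A (π ⟨$⟩ʳ_) a) (cong A eq))
  ...   | copy₂ b = b , ∈shadowᴮ S w∈S , λ eq → w-moved (trans (lift-map-B (π ⟨$⟩ʳ_) b) (cong B eq))

-- The graph G_m and the function g

pattern pendant = zero
pattern centre = suc zero
pattern clique i = suc (suc i)

G : (m : ℕ) → Adj (suc (suc m))
G m pendant centre = true
G m centre pendant = true
G m centre (clique _) = true
G m (clique _) centre = true
G m (clique i) (clique j) = not ⌊ i ≟ j ⌋
G m _ _ = false

g : ∀ {m} → Fin (suc (suc m)) → Fin (suc (suc m))
g pendant = centre
g centre = pendant
g (clique i) = clique i

G-simple : ∀ m → IsSimple (G m)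
G-simple m = G-sym , G-loopless
  where
  G-sym : ∀ a b → G m a b ≡ G m b a
  G-sym pendant pendant = refl
  G-sym pendant centre = refl
  G-sym pendant (clique _) = refl
  G-sym centre pendant = refl
  G-sym centre centre = refl
  G-sym centre (clique _) = refl
  G-sym (clique _) pendant = refl
  G-sym (clique _) centre = refl
  G-sym (clique i) (clique j) = cong not (⌊≟⌋-sym i j)
  G-loopless : ∀ a → G m a a ≡ false
  G-loopless pendant = refl
  G-loopless centre = refl
  G-loopless (clique i) = cong not (⌊≟⌋-refl i)

-- Every vertex is at distance at most one from the centre.
G-connected : ∀ m → IsConnected (G m)
G-connected m u v = to-centre u (from-centre v)
  where
  from-centre : ∀ v → Reachable (G m) centre v
  from-centre pendant = step refl here
  from-centre centre = here
  from-centre (clique _) = step refl here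
  to-centre : ∀ u → Reachable (G m) centre v → Reachable (G m) u v
  to-centre pendant r = step refl r
  to-centre centre r = r
  to-centre (clique _) r = step refl r

-- Distinct clique vertices are twins: both are adjacent to the centre and to
-- every other clique vertex, and not to the pendant vertex.
clique-twins : ∀ m (i j : Fin m) → Twins (G m) (clique i) (clique j)
clique-twins m i j pendant _ _ = refl
clique-twins m i j centre _ _ = refl
clique-twins m i j (clique k) k≢i k≢j =
  cong not (trans (⌊≟⌋-distinct (k≢i ∘ cong clique ∘ sym)) (sym (⌊≟⌋-distinct (k≢j ∘ cong clique ∘ sym))))

clique-injective : ∀ {m} {i j : Fin m} → Fin.suc (suc i) ≡ suc (suc j) → i ≡ j
clique-injective = suc-injective ∘ suc-injective

-- Only a clique vertex is mapped by g to itself, so g commutes with the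
-- transposition of two clique vertices.
g-clique-preimage : ∀ {m} (i : Fin m) k → g k ≡ clique i → k ≡ clique i
g-clique-preimage i pendant ()
g-clique-preimage i centre ()
g-clique-preimage i (clique k) eq = eq

g-commutes-clique-transposition : ∀ {m} (i j : Fin m) k →
  g (transpose (clique i) (clique j) ⟨$⟩ʳ k) ≡ transpose (clique i) (clique j) ⟨$⟩ʳ g k
g-commutes-clique-transposition i j =
  transpose-commutes g (clique i) (clique j) refl refl (g-clique-preimage i) (g-clique-preimage j)

CliqueCover : ∀ {m} → Subset (suc (suc m)) → Set
CliqueCover {m} S = ∀ (i j : Fin m) → i ≢ j → clique i ∈ S ⊎ clique j ∈ S

clique-part-size : ∀ {m} (p q : Bool) (u : Subset m) → CliqueCover (p ∷ q ∷ u) → m ≤ suc ∣ u ∣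
clique-part-size p q u cover = meetsAllPairs-size u λ i j i≢j →
  Sum.map (drop-there ∘ drop-there) (drop-there ∘ drop-there) (cover i j i≢j)

cliqueCover-size : ∀ {m} (S : Subset (suc (suc m))) → CliqueCover S → m ≤ suc ∣ S ∣
cliqueCover-size (p ∷ q ∷ u) cover =
  ≤-trans (clique-part-size p q u cover) (s≤s (≤-trans (∣p∣≤∣x∷p∣ q u) (∣p∣≤∣x∷p∣ p (q ∷ u))))

cliqueCover-size-pendant : ∀ {m} (S : Subset (suc (suc m))) → CliqueCover S → pendant ∈ S → m ≤ ∣ S ∣
cliqueCover-size-pendant (inside ∷ q ∷ u) cover here =
  ≤-trans (clique-part-size inside q u cover) (s≤s (∣p∣≤∣x∷p∣ q u))

-- Fixing numbers of G_m and F_{G_m} for m = t + 2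

module Construction (t : ℕ) where

  m : ℕ
  m = suc (suc t)

  x₀ x₁ : Fin (suc (suc m))
  x₀ = clique zero
  x₁ = clique (suc zero)

  G-fixingSet-cover : (S : Subset (suc (suc m))) → IsFixingSet (G m) S → CliqueCover S
  G-fixingSet-cover S fixing i j i≢j =
    fixingSet-meets-twins (G m) (G-simple m) (i≢j ∘ clique-injective) (clique-twins m i j) S fixing

  -- The clique without x₀.
  SG : Subset (suc (suc m))
  SG = outside ∷ outside ∷ outside ∷ ⊤

  SG-fixing : IsFixingSet (G m) SG
  SG-fixing σ aut fixes = fixes-all-but-one σ x₀ fixed
    where
    clique-fixed : ∀ k → σ ⟨$⟩ʳ clique (suc k) ≡ clique (suc k)
    clique-fixed k = fixes _ (there (there (there ∈⊤)))
    only-pendant : ∀ w → G m w x₁ ≡ false → (∀ k → w ≢ clique (suc k)) → w ≡ pendant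
    only-pendant pendant _ _ = refl
    only-pendant centre () _
    only-pendant (clique zero) () _
    only-pendant (clique (suc k)) _ w≢ = ⊥-elim (w≢ k refl)
    pendant-fixed : σ ⟨$⟩ʳ pendant ≡ pendant
    pendant-fixed = only-pendant _ (adjacency-to-fixed (G m) σ aut (clique-fixed zero) pendant)
      (λ k → distinct-from-fixed σ (clique-fixed k) (λ ()))
    only-centre : ∀ w → G m w pendant ≡ true → w ≡ centre
    only-centre pendant ()
    only-centre centre _ = refl
    only-centre (clique _) ()
    fixed : ∀ w → w ≢ x₀ → σ ⟨$⟩ʳ w ≡ w
    fixed pendant _ = pendant-fixed
    fixed centre _ = only-centre _ (adjacency-to-fixed (G m) σ aut pendant-fixed centre)
    fixed (clique zero) w≢x₀ = ⊥-elim (w≢x₀ refl)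
    fixed (clique (suc k)) _ = clique-fixed k

  G-fix-number : FixNumber (G m) (suc t)
  G-fix-number = (SG , SG-fixing , ∣⊤∣≡n (suc t)) ,
    λ S fixing → ≤-pred (cliqueCover-size S (G-fixingSet-cover S fixing))

  open Functigraph (G m) g

  pendant-copies-twins : Twins F (A pendant) (B pendant)
  pendant-copies-twins w w≢Ad w≢Bd with copy w
  ... | copy₁ a = trans (adjᴬᴬ pendant a) (trans (on-A a (w≢Ad ∘ cong A)) (sym (adjᴮᴬ pendant a)))
    where
    on-A : ∀ a → a ≢ pendant → G m pendant a ≡ ⌊ g a ≟ pendant ⌋
    on-A pendant a≢d = ⊥-elim (a≢d refl)
    on-A centre _ = refl
    on-A (clique _) _ = refl
  ... | copy₂ b = trans (adjᴬᴮ pendant b) (trans (on-B b (w≢Bd ∘ cong B)) (sym (adjᴮᴮ pendant b)))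
    where
    on-B : ∀ b → b ≢ pendant → ⌊ g {m} pendant ≟ b ⌋ ≡ G m pendant b
    on-B pendant b≢d = ⊥-elim (b≢d refl)
    on-B centre _ = refl
    on-B (clique _) _ = refl

  F-fixingSet-shadow : (S : Subset (suc (suc m) + suc (suc m))) → IsFixingSet F S →
    pendant ∈ shadow S × CliqueCover (shadow S)
  F-fixingSet-shadow S fixing = pendant-in-shadow , cover
    where
    pendant-in-shadow : pendant ∈ shadow S
    pendant-in-shadow = [ ∈shadowᴬ S , ∈shadowᴮ S ]′
      (fixingSet-meets-twins F (F-simple (G-simple m)) (A≢B pendant pendant) pendant-copies-twins S fixing)
    cover : CliqueCover (shadow S)
    cover i j i≢j
      with shadow-meets-support S fixing (transpose (clique i) (clique j))
             (twins-transposition (G m) (G-simple m) (clique-twins m i j))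
             (g-commutes-clique-transposition i j)
             (transpose-moves (clique i) (clique j) (i≢j ∘ clique-injective))
    ... | a , a∈shadow , a-moved with moved-by-transpose (clique i) (clique j) a-moved
    ...   | inj₁ refl = inj₁ a∈shadow
    ...   | inj₂ refl = inj₂ a∈shadow

  only-A-centre : ∀ w → F w (A pendant) ≡ true → F w (A x₁) ≡ true → w ≡ A centre
  only-A-centre w adj-d adj-x₁ with copy w
  ... | copy₁ a = cong A (on-A a (trans (sym (adjᴬᴬ a pendant)) adj-d) (trans (sym (adjᴬᴬ a x₁)) adj-x₁))
    where
    on-A : ∀ a → G m a pendant ≡ true → G m a x₁ ≡ true → a ≡ centre
    on-A pendant () _
    on-A centre _ _ = refl
    on-A (clique _) () _
  ... | copy₂ b = ⊥-elim (on-B b (trans (sym (adjᴮᴬ b pendant)) adj-d) (trans (sym (adjᴮᴬ b x₁)) adj-x₁))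
    where
    on-B : ∀ b → ⌊ g pendant ≟ b ⌋ ≡ true → ⌊ g x₁ ≟ b ⌋ ≡ true → Empty
    on-B pendant () _
    on-B centre _ ()
    on-B (clique _) () _

  only-B-centre : ∀ w → F w (A pendant) ≡ true → F w (A x₁) ≡ false → w ≡ B centre
  only-B-centre w adj-d nonadj-x₁ with copy w
  ... | copy₁ a = ⊥-elim (on-A a (trans (sym (adjᴬᴬ a pendant)) adj-d) (trans (sym (adjᴬᴬ a x₁)) nonadj-x₁))
    where
    on-A : ∀ a → G m a pendant ≡ true → G m a x₁ ≡ false → Empty
    on-A pendant () _
    on-A centre _ ()
    on-A (clique _) () _
  ... | copy₂ b = cong B (sym (⌊≟⌋-true (trans (sym (adjᴮᴬ b pendant)) adj-d)))

  only-B-clique : ∀ k w → F w (A (clique (suc k))) ≡ true → F w (B centre) ≡ true → w ≡ B (clique (suc k))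
  only-B-clique k w adj-x adj-c with copy w
  ... | copy₁ a = ⊥-elim (on-A a (trans (sym (adjᴬᴬ a (clique (suc k)))) adj-x) (trans (sym (adjᴬᴮ a centre)) adj-c))
    where
    on-A : ∀ a → G m a (clique (suc k)) ≡ true → ⌊ g a ≟ centre ⌋ ≡ true → Empty
    on-A pendant () _
    on-A centre _ ()
    on-A (clique _) _ ()
  ... | copy₂ b = cong B (sym (⌊≟⌋-true (trans (sym (adjᴮᴬ b (clique (suc k)))) adj-x)))

  only-B-pendant : ∀ w → F w (A centre) ≡ true → F w (B centre) ≡ true → w ≢ A pendant → w ≡ B pendant
  only-B-pendant w adj-Ac adj-Bc w≢Ad with copy w
  ... | copy₁ a = ⊥-elim (on-A a (trans (sym (adjᴬᴬ a centre)) adj-Ac) (trans (sym (adjᴬᴮ a centre)) adj-Bc) (w≢Ad ∘ cong A))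
    where
    on-A : ∀ a → G m a centre ≡ true → ⌊ g a ≟ centre ⌋ ≡ true → a ≢ pendant → Empty
    on-A pendant _ _ a≢d = a≢d refl
    on-A centre () _ _
    on-A (clique _) _ () _
  ... | copy₂ b = cong B (sym (⌊≟⌋-true (trans (sym (adjᴮᴬ b centre)) adj-Ac)))

  only-A-x₀ : ∀ w → F w (A centre) ≡ true → F w (A x₁) ≡ true →
    (∀ k → w ≢ A (clique (suc (suc k)))) → w ≡ A x₀
  only-A-x₀ w adj-c adj-x₁ w≢ with copy w
  ... | copy₁ a = cong A (on-A a (trans (sym (adjᴬᴬ a centre)) adj-c) (trans (sym (adjᴬᴬ a x₁)) adj-x₁) (λ k → w≢ k ∘ cong A))
    where
    on-A : ∀ a → G m a centre ≡ true → G m a x₁ ≡ true → (∀ k → a ≢ clique (suc (suc k))) → a ≡ x₀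
    on-A pendant _ () _
    on-A centre () _ _
    on-A (clique zero) _ _ _ = refl
    on-A (clique (suc zero)) _ () _
    on-A (clique (suc (suc k))) _ _ a≢ = ⊥-elim (a≢ k refl)
  ... | copy₂ b = ⊥-elim (on-B b (trans (sym (adjᴮᴬ b centre)) adj-c) (trans (sym (adjᴮᴬ b x₁)) adj-x₁))
    where
    on-B : ∀ b → ⌊ g centre ≟ b ⌋ ≡ true → ⌊ g x₁ ≟ b ⌋ ≡ true → Empty
    on-B pendant _ ()
    on-B (suc _) () _

  -- The pendant vertex and the clique without x₀, all in the copy G₁.
  SF₁ : Subset (suc (suc m))
  SF₁ = inside ∷ outside ∷ outside ∷ ⊤

  SF : Subset (suc (suc m) + suc (suc m))
  SF = SF₁ ++ ⊥

  SF-size : ∣ SF ∣ ≡ suc (suc t)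
  SF-size = begin
    ∣ SF ∣                                                 ≡⟨ ∣p++q∣ SF₁ ⊥ ⟩
    suc ∣ ⊤ {suc t} ∣ + ∣ ⊥ {suc (suc m)} ∣                ≡⟨ cong₂ (λ k l → suc k + l) (∣⊤∣≡n (suc t)) (∣⊥∣≡0 (suc (suc m))) ⟩
    suc (suc t) + 0                                        ≡⟨ +-identityʳ (suc (suc t)) ⟩
    suc (suc t)                                            ∎

  SF-fixing : IsFixingSet F SF
  SF-fixing σ aut fixes = fixes-all-but-one σ (B x₀) fixed
    where
    preserves = adjacency-to-fixed F σ aut
    Ad-fixed : σ ⟨$⟩ʳ A pendant ≡ A pendant
    Ad-fixed = fixes _ (∈++ˡ SF₁ ⊥ here)
    Ax-fixed : ∀ k → σ ⟨$⟩ʳ A (clique (suc k)) ≡ A (clique (suc k))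
    Ax-fixed k = fixes _ (∈++ˡ SF₁ ⊥ (there (there (there ∈⊤))))
    Ac-fixed : σ ⟨$⟩ʳ A centre ≡ A centre
    Ac-fixed = only-A-centre _
      (trans (preserves Ad-fixed (A centre)) (adjᴬᴬ centre pendant))
      (trans (preserves (Ax-fixed zero) (A centre)) (adjᴬᴬ centre x₁))
    Bc-fixed : σ ⟨$⟩ʳ B centre ≡ B centre
    Bc-fixed = only-B-centre _
      (trans (preserves Ad-fixed (B centre)) (adjᴮᴬ centre pendant))
      (trans (preserves (Ax-fixed zero) (B centre)) (adjᴮᴬ centre x₁))
    Bx-fixed : ∀ k → σ ⟨$⟩ʳ B (clique (suc k)) ≡ B (clique (suc k))
    Bx-fixed k = only-B-clique k _
      (trans (preserves (Ax-fixed k) (B x)) (trans (adjᴮᴬ x x) (⌊≟⌋-refl x)))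
      (trans (preserves Bc-fixed (B x)) (adjᴮᴮ x centre))
      where x = clique (suc k)
    Bd-fixed : σ ⟨$⟩ʳ B pendant ≡ B pendant
    Bd-fixed = only-B-pendant _
      (trans (preserves Ac-fixed (B pendant)) (adjᴮᴬ pendant centre))
      (trans (preserves Bc-fixed (B pendant)) (adjᴮᴮ pendant centre))
      (distinct-from-fixed σ Ad-fixed (A≢B pendant pendant ∘ sym))
    Ax₀-fixed : σ ⟨$⟩ʳ A x₀ ≡ A x₀
    Ax₀-fixed = only-A-x₀ _
      (trans (preserves Ac-fixed (A x₀)) (adjᴬᴬ x₀ centre))
      (trans (preserves (Ax-fixed zero) (A x₀)) (adjᴬᴬ x₀ x₁))
      (λ k → distinct-from-fixed σ (Ax-fixed (suc k)) (x₀≢ k ∘ ↑ˡ-injective _ _ _))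
      where
      x₀≢ : ∀ k → x₀ ≢ clique (suc (suc k))
      x₀≢ k ()
    fixed : ∀ w → w ≢ B x₀ → σ ⟨$⟩ʳ w ≡ w
    fixed w w≢Bx₀ with copy w
    ... | copy₁ pendant = Ad-fixed
    ... | copy₁ centre = Ac-fixed
    ... | copy₁ (clique zero) = Ax₀-fixed
    ... | copy₁ (clique (suc k)) = Ax-fixed k
    ... | copy₂ pendant = Bd-fixed
    ... | copy₂ centre = Bc-fixed
    ... | copy₂ (clique zero) = ⊥-elim (w≢Bx₀ refl)
    ... | copy₂ (clique (suc k)) = Bx-fixed k

  F-fix-number : FixNumber F (suc (suc t))
  F-fix-number = (SF , SF-fixing , SF-size) , λ S fixing →
    let (pendant-in-shadow , cover) = F-fixingSet-shadow S fixing
    in ≤-trans (cliqueCover-size-pendant (shadow S) cover pendant-in-shadow) (∣shadow∣≤∣S∣ S)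

mainTheorem4 : ∀ (t₁ : ℕ) → 2 ≤ t₁ →
    Σ ℕ (λ n → Σ (Adj n) (λ G → Σ (Fin n → Fin n) (λ g →
    IsSimple G × IsConnected G × FixNumber G t₁ × FixNumber (functigraph G g) (suc t₁))))
mainTheorem4 (suc t) _ =
  suc (suc (suc (suc t))) , G (suc (suc t)) , g ,
  G-simple (suc (suc t)) , G-connected (suc (suc t)) , G-fix-number , F-fix-number
  where open Construction t
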